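{- Every $n$-step staircase $\mathcal{C}\subseteq\mathbb{Z}^3$ is a poly-antimatroid.
   Context: A point $A=(x_A,y_A,z_A)\in\mathbb{Z}^3$ is regarded as a multiset over $\{x,y,z\}$. $A\subseteq B$ means coordinatewise $\le$; $A\cup B$ is the coordinatewise maximum. A poly-antimatroid (in $\mathbb{Z}^3$) is a finite nonempty set $S$ of points such that (A1) for each $A\in S$ with $A\neq(0,0,0)$ there is a standard unit vector $e$ with $A-e\in S$; (A2) for all $A,B\in S$ with $A\not\subseteq B$ there is a coordinate $i$ with $A_i>B_i$ such that $B+e_i\in S$ ($e_i$ the $i$-th unit vector). A digital cuboid is a set $C=\{(x,y,z)\in\mathbb{Z}^3: x_{\min}\le x\le x_{\max},\ y_{\min}\le y\le y_{\max},\ z_{\min}\le z\le z_{\max}\}$ with $|C|>1$. A sequence of cuboids $C_1,\dots,C_n$ (with $C_i$ having parameters $x^i_{\min},x^i_{\max}$, etc.) is regular if (a) $x^1_{\min}=y^1_{\min}=z^1_{\min}=0$; (b) for each $1\le i\le n-1$: $x^i_{\min}\le x^{i+1}_{\min}$, $y^i_{\min}\le y^{i+1}_{\min}$, $z^i_{\min}\le z^{i+1}_{\min}$, with at least one strict inequality; (c) for each $1\le i\le n-1$: $x^{i+1}_{\min}\le x^i_{\max}$, $y^{i+1}_{\min}\le y^i_{\max}$, $z^{i+1}_{\min}\le z^i_{\max}$; (d) for each $1\le i\le n-1$: $x^i_{\max}\le x^{i+1}_{\max}$, $y^i_{\max}\le y^{i+1}_{\max}$, $z^i_{\max}\le z^{i+1}_{\max}$,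 with at least one strict inequality. The union $\mathcal{C}=C_1\cup\dots\cup C_n$ of a regular sequence is an $n$-step staircase. -}

module Defs where

open import Data.Integer using (ℤ; +_; _+_; _-_; _≤_; _<_; 1ℤ; 0ℤ)
open import Data.Nat using (ℕ; suc)
open import Data.Fin using (Fin; zero; suc; inject₁)
open import Data.Product using (Σ; ∃; _×_; _,_)
open import Data.Sum using (_⊎_)
open import Data.List using (List)
open import Data.List.Membership.Propositional using (_∈_)
open import Relation.Nullary using (¬_)
open import Relation.Binary.PropositionalEquality using (_≡_)
open import Level using (0ℓ)

record Point : Set where
  constructor pt
  field
    px py pz : ℤ
open Point public

origin : Point
origin = pt 0ℤ 0ℤ 0ℤ

coord : Point → Fin 3 → ℤ
coord A zero = px A
coord A (suc zero) = py A
coord A (suc (suc zero)) = pz A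

addUnit : Point → Fin 3 → Point
addUnit (pt a b c) zero = pt (a + 1ℤ) b c
addUnit (pt a b c) (suc zero) = pt a (b + 1ℤ) c
addUnit (pt a b c) (suc (suc zero)) = pt a b (c + 1ℤ)

subUnit : Point → Fin 3 → Point
subUnit (pt a b c) zero = pt (a - 1ℤ) b c
subUnit (pt a b c) (suc zero) = pt a (b - 1ℤ) c
subUnit (pt a b c) (suc (suc zero)) = pt a b (c - 1ℤ)

-- multiset inclusion: coordinatewise ≤
_⊆ᵖ_ : Point → Point → Set
A ⊆ᵖ B = (i : Fin 3) → coord A i ≤ coord B i

PointSet : Set₁
PointSet = Point → Set

Finite : PointSet → Set
Finite S = ∃ λ (xs : List Point) → ∀ A → S A → A ∈ xs

record PolyAntimatroid (S : PointSet) : Set where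
  field
    finite   : Finite S
    nonempty : ∃ λ A → S A
    A1 : ∀ A → S A → ¬ (A ≡ origin) → ∃ λ (i : Fin 3) → S (subUnit A i)
    A2 : ∀ A B → S A → S B → ¬ (A ⊆ᵖ B) →
         ∃ λ (i : Fin 3) → (coord B i < coord A i) × S (addUnit B i)

record Cuboid : Set where
  field
    xmin xmax ymin ymax zmin zmax : ℤ
open Cuboid public

_∈C_ : Point → Cuboid → Set
A ∈C C = (xmin C ≤ px A × px A ≤ xmax C)
       × (ymin C ≤ py A × py A ≤ ymax C)
       × (zmin C ≤ pz A × pz A ≤ zmax C)

IsDigitalCuboid : Cuboid → Set
IsDigitalCuboid C = ∃ λ P → ∃ λ Q → P ∈C C × Q ∈C C × ¬ (P ≡ Q)

-- a sequence C₁,…,Cₙ with n = suc m, indexed by Fin (suc m)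
Regular : (m : ℕ) → (Fin (suc m) → Cuboid) → Set
Regular m C =
  ((i : Fin (suc m)) → IsDigitalCuboid (C i))
  × (xmin (C zero) ≡ 0ℤ × ymin (C zero) ≡ 0ℤ × zmin (C zero) ≡ 0ℤ)
  × ((i : Fin m) →
      let D = C (inject₁ i) ; E = C (suc i) in
      ((xmin D ≤ xmin E × ymin D ≤ ymin E × zmin D ≤ zmin E)
        × (xmin D < xmin E ⊎ ymin D < ymin E ⊎ zmin D < zmin E))
      × (xmin E ≤ xmax D × ymin E ≤ ymax D × zmin E ≤ zmax D)
      × ((xmax D ≤ xmax E × ymax D ≤ ymax E × zmax D ≤ zmax E)
        × (xmax D < xmax E ⊎ ymax D < ymax E ⊎ zmax D < zmax E)))

Union : (m : ℕ) → (Fin (suc m) → Cuboid) → PointSet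
Union m C A = ∃ λ (i : Fin (suc m)) → A ∈C C i

-- A cuboid is the interval [lower, upper] of the coordinatewise order, and along a regular
-- sequence both corners increase.  (A1) A point strictly above the lower corner of its cuboid
-- steps down inside it; the lower corner of C (i+1) lies in C i, strictly above the lower corner
-- of C i in some coordinate, so it steps down inside C i; the lower corner of C 0 is the origin.
-- (A2) Let A ∈ C i, B ∈ C j, and B behind A in some coordinate.  If B is below the top of C j in
-- such a coordinate, B moves up there.  Otherwise B is at the top of C j in every coordinate where
-- it is behind A; then j < i and B ∈ C (j+1), so the argument repeats one cuboid higher and must
-- succeed before the last one.  The union is finite, lying between the origin and the upper
-- corner of the last cuboid.
module Submission where

open import Defs
open import Data.Nat using (ℕ; suc)
open import Data.Fin using (Fin)

open import Data.Fin as Fin using (zero; suc; inject₁; fromℕ; _≟_)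
open import Data.Fin.Properties using (any?; ¬∀⟶∃¬; ≤fromℕ; toℕ-inject₁)
open import Data.Fin.Induction using (<-weakInduction-startingFrom; >-weakInduction)
import Data.Nat as ℕ
import Data.Nat.Properties as ℕ
open import Data.Integer using (ℤ; +_; -[1+_]; _+_; _-_; _≤_; _<_; +≤+; 0ℤ; 1ℤ; -1ℤ; ∣_∣)
open import Data.Integer.Properties
  using (≤-refl; ≤-trans; ≤-antisym; <-≤-trans; ≤-<-trans; <⇒≱; ≮⇒≥; ≰⇒>; _<?_; _≤?_;
         +-comm; i≤i+j; i≤j⇒i-k≤j; i<j⇒suc[i]≤j; i<j⇒i≤pred[j])
open import Data.Product using (∃; _×_; _,_; proj₁; proj₂; map₂)
open import Data.Sum using (_⊎_; inj₁; inj₂)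
open import Data.List using (List; map; upTo; cartesianProduct; cartesianProductWith)
open import Data.List.Membership.Propositional using (_∈_)
open import Data.List.Membership.Propositional.Properties
  using (∈-map⁺; ∈-upTo⁺; ∈-cartesianProduct⁺; ∈-cartesianProductWith⁺)
open import Relation.Binary.Core using (Rel)
open import Relation.Binary.Definitions using (Reflexive; Transitive)
open import Relation.Nullary using (¬_; yes; no; contradiction)
open import Relation.Nullary.Decidable using (_×-dec_)
open import Relation.Binary.PropositionalEquality using (_≡_; _≢_; refl; sym; subst)
open import Function using (_∘_)

monotone-chain : ∀ {a ℓ} {X : Set a} (_≼_ : Rel X ℓ) → Reflexive _≼_ → Transitive _≼_ →
                 ∀ {m} (f : Fin (suc m) → X) → (∀ i → f (inject₁ i) ≼ f (suc i)) →
                 ∀ {i j} → i Fin.≤ j → f i ≼ f j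
monotone-chain _≼_ ≼-refl ≼-trans f step {i} =
  <-weakInduction-startingFrom (λ j → f i ≼ f j) ≼-refl (λ j fi≼fj → ≼-trans fi≼fj (step j))

i<j⇒i+1≤j : ∀ {i j} → i < j → i + 1ℤ ≤ j
i<j⇒i+1≤j {i} i<j = subst (_≤ _) (+-comm 1ℤ i) (i<j⇒suc[i]≤j i<j)

i<j⇒i≤j-1 : ∀ {i j} → i < j → i ≤ j - 1ℤ
i<j⇒i≤j-1 {j = j} i<j = subst (_ ≤_) (+-comm -1ℤ j) (i<j⇒i≤pred[j] i<j)

coord-injective : ∀ {A B} → (∀ k → coord A k ≡ coord B k) → A ≡ B
coord-injective {pt _ _ _} {pt _ _ _} eq with eq zero | eq (suc zero) | eq (suc (suc zero))
... | refl | refl | refl = refl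

⊆ᵖ-refl : ∀ {A} → A ⊆ᵖ A
⊆ᵖ-refl k = ≤-refl

⊆ᵖ-trans : ∀ {A B D} → A ⊆ᵖ B → B ⊆ᵖ D → A ⊆ᵖ D
⊆ᵖ-trans A⊆B B⊆D k = ≤-trans (A⊆B k) (B⊆D k)

⊆ᵖ-antisym : ∀ {A B} → A ⊆ᵖ B → B ⊆ᵖ A → A ≡ B
⊆ᵖ-antisym A⊆B B⊆A = coord-injective λ k → ≤-antisym (A⊆B k) (B⊆A k)

⊆ᵖ⇒≡⊎< : ∀ {A B} → A ⊆ᵖ B → A ≡ B ⊎ ∃ λ k → coord A k < coord B k
⊆ᵖ⇒≡⊎< {A} {B} A⊆B with any? (λ k → coord A k <? coord B k)
... | yes A<B = inj₂ A<B
... | no  A≮B = inj₁ (⊆ᵖ-antisym A⊆B λ k → ≮⇒≥ (A≮B ∘ (k ,_)))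

⊆ᵖ-intro : ∀ {A B} → px A ≤ px B × py A ≤ py B × pz A ≤ pz B → A ⊆ᵖ B
⊆ᵖ-intro (x , y , z) zero             = x
⊆ᵖ-intro (x , y , z) (suc zero)       = y
⊆ᵖ-intro (x , y , z) (suc (suc zero)) = z

<-intro : ∀ {A B} → px A < px B ⊎ py A < py B ⊎ pz A < pz B → ∃ λ k → coord A k < coord B k
<-intro (inj₁ x)        = zero , x
<-intro (inj₂ (inj₁ y)) = suc zero , y
<-intro (inj₂ (inj₂ z)) = suc (suc zero) , z

coord-addUnit-≡ : ∀ A k → coord (addUnit A k) k ≡ coord A k + 1ℤ
coord-addUnit-≡ (pt _ _ _) zero             = refl
coord-addUnit-≡ (pt _ _ _) (suc zero)       = refl
coord-addUnit-≡ (pt _ _ _) (suc (suc zero)) = refl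

coord-addUnit-≢ : ∀ A {k l} → k ≢ l → coord (addUnit A k) l ≡ coord A l
coord-addUnit-≢ (pt _ _ _) {zero}           {zero}           k≢l = contradiction refl k≢l
coord-addUnit-≢ (pt _ _ _) {zero}           {suc zero}       _   = refl
coord-addUnit-≢ (pt _ _ _) {zero}           {suc (suc zero)} _   = refl
coord-addUnit-≢ (pt _ _ _) {suc zero}       {zero}           _   = refl
coord-addUnit-≢ (pt _ _ _) {suc zero}       {suc zero}       k≢l = contradiction refl k≢l
coord-addUnit-≢ (pt _ _ _) {suc zero}       {suc (suc zero)} _   = refl
coord-addUnit-≢ (pt _ _ _) {suc (suc zero)} {zero}           _   = refl
coord-addUnit-≢ (pt _ _ _) {suc (suc zero)} {suc zero}       _   = refl
coord-addUnit-≢ (pt _ _ _) {suc (suc zero)} {suc (suc zero)} k≢l = contradiction refl k≢l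

coord-subUnit-≡ : ∀ A k → coord (subUnit A k) k ≡ coord A k - 1ℤ
coord-subUnit-≡ (pt _ _ _) zero             = refl
coord-subUnit-≡ (pt _ _ _) (suc zero)       = refl
coord-subUnit-≡ (pt _ _ _) (suc (suc zero)) = refl

coord-subUnit-≢ : ∀ A {k l} → k ≢ l → coord (subUnit A k) l ≡ coord A l
coord-subUnit-≢ (pt _ _ _) {zero}           {zero}           k≢l = contradiction refl k≢l
coord-subUnit-≢ (pt _ _ _) {zero}           {suc zero}       _   = refl
coord-subUnit-≢ (pt _ _ _) {zero}           {suc (suc zero)} _   = refl
coord-subUnit-≢ (pt _ _ _) {suc zero}       {zero}           _   = refl
coord-subUnit-≢ (pt _ _ _) {suc zero}       {suc zero}       k≢l = contradiction refl k≢l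
coord-subUnit-≢ (pt _ _ _) {suc zero}       {suc (suc zero)} _   = refl
coord-subUnit-≢ (pt _ _ _) {suc (suc zero)} {zero}           _   = refl
coord-subUnit-≢ (pt _ _ _) {suc (suc zero)} {suc zero}       _   = refl
coord-subUnit-≢ (pt _ _ _) {suc (suc zero)} {suc (suc zero)} k≢l = contradiction refl k≢l

infix 4 _∈[_,_]
_∈[_,_] : Point → Point → Point → Set
A ∈[ L , U ] = L ⊆ᵖ A × A ⊆ᵖ U

∈[]-update : ∀ {L U A A′ k} → A ∈[ L , U ] → (∀ {l} → k ≢ l → coord A′ l ≡ coord A l) →
             coord L k ≤ coord A′ k × coord A′ k ≤ coord U k → A′ ∈[ L , U ]
∈[]-update {L} {U} {A} {A′} {k} (L⊆A , A⊆U) unchanged bounds-k =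
  proj₁ ∘ bounds , proj₂ ∘ bounds
  where
  bounds : ∀ l → coord L l ≤ coord A′ l × coord A′ l ≤ coord U l
  bounds l with k ≟ l
  ... | yes refl = bounds-k
  ... | no  k≢l rewrite unchanged k≢l = L⊆A l , A⊆U l

addUnit-∈[] : ∀ {L U A} k → A ∈[ L , U ] → coord A k < coord U k → addUnit A k ∈[ L , U ]
addUnit-∈[] {L} {U} {A} k A∈ A<U =
  ∈[]-update A∈ (coord-addUnit-≢ A)
    (subst (λ a → coord L k ≤ a × a ≤ coord U k) (sym (coord-addUnit-≡ A k))
      (≤-trans (proj₁ A∈ k) (i≤i+j _ 1ℤ) , i<j⇒i+1≤j A<U))

subUnit-∈[] : ∀ {L U A} k → A ∈[ L , U ] → coord L k < coord A k → subUnit A k ∈[ L , U ]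
subUnit-∈[] {L} {U} {A} k A∈ L<A =
  ∈[]-update A∈ (coord-subUnit-≢ A)
    (subst (λ a → coord L k ≤ a × a ≤ coord U k) (sym (coord-subUnit-≡ A k))
      (i<j⇒i≤j-1 L<A , i≤j⇒i-k≤j 1ℤ (proj₂ A∈ k)))

interval₀ : ℤ → List ℤ
interval₀ u = map +_ (upTo (suc ∣ u ∣))

∈-interval₀ : ∀ {a u} → 0ℤ ≤ a → a ≤ u → a ∈ interval₀ u
∈-interval₀ { -[1+ _ ]} ()
∈-interval₀ {+ _} {+ _}      _ (+≤+ a≤u) = ∈-map⁺ +_ (∈-upTo⁺ (ℕ.s≤s a≤u))
∈-interval₀ {+ _} { -[1+ _ ]} _ ()

grid : Point → List Point
grid U = cartesianProductWith (λ a bc → pt a (proj₁ bc) (proj₂ bc))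
           (interval₀ (px U)) (cartesianProduct (interval₀ (py U)) (interval₀ (pz U)))

∈-grid : ∀ {A U} → A ∈[ origin , U ] → A ∈ grid U
∈-grid {pt _ _ _} (0⊆A , A⊆U) =
  ∈-cartesianProductWith⁺ _ (∈-interval₀ (0⊆A zero) (A⊆U zero))
    (∈-cartesianProduct⁺ (∈-interval₀ (0⊆A (suc zero)) (A⊆U (suc zero)))
                          (∈-interval₀ (0⊆A (suc (suc zero))) (A⊆U (suc (suc zero)))))

lower upper : Cuboid → Point
lower C = pt (xmin C) (ymin C) (zmin C)
upper C = pt (xmax C) (ymax C) (zmax C)

∈C⇒∈[] : ∀ {A C} → A ∈C C → A ∈[ lower C , upper C ]
∈C⇒∈[] ((x₁ , x₂) , (y₁ , y₂) , (z₁ , z₂)) = ⊆ᵖ-intro (x₁ , y₁ , z₁) , ⊆ᵖ-intro (x₂ , y₂ , z₂)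

∈[]⇒∈C : ∀ {A C} → A ∈[ lower C , upper C ] → A ∈C C
∈[]⇒∈C (L⊆A , A⊆U) =
  (L⊆A zero , A⊆U zero) , (L⊆A (suc zero) , A⊆U (suc zero)) , (L⊆A (suc (suc zero)) , A⊆U (suc (suc zero)))

module Staircase {m : ℕ} (C : Fin (suc m) → Cuboid) (regular : Regular m C) where

  S : PointSet
  S = Union m C

  lo hi : Fin (suc m) → Point
  lo i = lower (C i)
  hi i = upper (C i)

  infix 4 _∈ᶜ_
  _∈ᶜ_ : Point → Fin (suc m) → Set
  A ∈ᶜ i = A ∈[ lo i , hi i ]

  ∈ᶜ⇒∈S : ∀ {A} i → A ∈ᶜ i → S A
  ∈ᶜ⇒∈S i A∈ = i , ∈[]⇒∈C A∈

  lo₀≡origin : lo zero ≡ origin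
  lo₀≡origin = let x₀ , y₀ , z₀ = proj₁ (proj₂ regular) in
    coord-injective λ { zero → x₀ ; (suc zero) → y₀ ; (suc (suc zero)) → z₀ }

  lo-step : ∀ i → lo (inject₁ i) ⊆ᵖ lo (suc i)
  lo-step i = ⊆ᵖ-intro (proj₁ (proj₁ (proj₂ (proj₂ regular) i)))

  lo-step-strict : ∀ i → ∃ λ k → coord (lo (inject₁ i)) k < coord (lo (suc i)) k
  lo-step-strict i = <-intro (proj₂ (proj₁ (proj₂ (proj₂ regular) i)))

  lo-overlap : ∀ i → lo (suc i) ⊆ᵖ hi (inject₁ i)
  lo-overlap i = ⊆ᵖ-intro (proj₁ (proj₂ (proj₂ (proj₂ regular) i)))

  hi-step : ∀ i → hi (inject₁ i) ⊆ᵖ hi (suc i)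
  hi-step i = ⊆ᵖ-intro (proj₁ (proj₂ (proj₂ (proj₂ (proj₂ regular) i))))

  lo-mono : ∀ {i j} → i Fin.≤ j → lo i ⊆ᵖ lo j
  lo-mono = monotone-chain _⊆ᵖ_ ⊆ᵖ-refl ⊆ᵖ-trans lo lo-step

  hi-mono : ∀ {i j} → i Fin.≤ j → hi i ⊆ᵖ hi j
  hi-mono = monotone-chain _⊆ᵖ_ ⊆ᵖ-refl ⊆ᵖ-trans hi hi-step

  ∈S⇒∈[origin,top] : ∀ A → S A → A ∈[ origin , hi (fromℕ m) ]
  ∈S⇒∈[origin,top] A (i , A∈) =
    ⊆ᵖ-trans (subst (_⊆ᵖ lo i) lo₀≡origin (lo-mono ℕ.z≤n)) (proj₁ (∈C⇒∈[] A∈)) ,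
    ⊆ᵖ-trans (proj₂ (∈C⇒∈[] A∈)) (hi-mono (≤fromℕ i))

  nonempty : ∃ S
  nonempty = let P , _ , P∈ , _ = proj₁ regular zero in P , zero , P∈

  lo-predecessor : ∀ i → ∃ λ k → subUnit (lo (suc i)) k ∈ᶜ inject₁ i
  lo-predecessor i = let k , lt = lo-step-strict i in k , subUnit-∈[] k (lo-step i , lo-overlap i) lt

  predecessor : ∀ A → S A → A ≢ origin → ∃ λ k → S (subUnit A k)
  predecessor A (i , A∈) A≢0 with ⊆ᵖ⇒≡⊎< (proj₁ (∈C⇒∈[] A∈))
  ... | inj₂ (k , lo<A) = k , ∈ᶜ⇒∈S i (subUnit-∈[] k (∈C⇒∈[] A∈) lo<A)
  predecessor _ (zero  , _) A≢0 | inj₁ refl = contradiction lo₀≡origin A≢0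
  predecessor _ (suc i , _) _   | inj₁ refl = map₂ (∈ᶜ⇒∈S (inject₁ i)) (lo-predecessor i)

  module Augment {A B : Point} {i : Fin (suc m)} (A∈i : A ∈ᶜ i) {k₀ : Fin 3}
                 (B<A : coord B k₀ < coord A k₀) where

    Augmentable : Set
    Augmentable = ∃ λ k → coord B k < coord A k × S (addUnit B k)

    Blocked : Fin (suc m) → Set
    Blocked j = ∀ k → coord B k < coord A k → coord (hi j) k ≤ coord B k

    augmentable⊎blocked : ∀ {j} → B ∈ᶜ j → Augmentable ⊎ Blocked j
    augmentable⊎blocked {j} B∈j
      with any? (λ k → (coord B k <? coord A k) ×-dec (coord B k <? coord (hi j) k))
    ... | yes (k , B<A , B<hi) = inj₁ (k , B<A , ∈ᶜ⇒∈S j (addUnit-∈[] k B∈j B<hi))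
    ... | no  ¬aug             = inj₂ λ k B<A → ≮⇒≥ λ B<hi → ¬aug (k , B<A , B<hi)

    blocked⇒< : ∀ {j} → Blocked j → j Fin.< i
    blocked⇒< {j} blocked = ℕ.≰⇒> λ i≤j →
      <⇒≱ (≤-<-trans (blocked k₀ B<A) (<-≤-trans B<A (proj₂ A∈i k₀))) (hi-mono i≤j k₀)

    -- Coordinates where B is behind A are at the top of the current cuboid, hence at least
    -- the bottom of the next one; the other coordinates are at least those of A ∈ C i.
    blocked⇒∈next : ∀ j → B ∈ᶜ inject₁ j → Blocked (inject₁ j) → B ∈ᶜ suc j
    blocked⇒∈next j (_ , B⊆hi) blocked = lo⊆B , ⊆ᵖ-trans B⊆hi (hi-step j)
      where
      sj≤i : suc j Fin.≤ i
      sj≤i = subst (λ t → suc t ℕ.≤ Fin.toℕ i) (toℕ-inject₁ j) (blocked⇒< blocked)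

      lo⊆B : lo (suc j) ⊆ᵖ B
      lo⊆B l with coord B l <? coord A l
      ... | yes B<A′ = ≤-trans (lo-overlap j l) (blocked l B<A′)
      ... | no  B≮A  = ≤-trans (lo-mono sj≤i l) (≤-trans (proj₁ A∈i l) (≮⇒≥ B≮A))

    augmentable : ∀ j → B ∈ᶜ j → Augmentable
    augmentable = >-weakInduction (λ j → B ∈ᶜ j → Augmentable) top down
      where
      top : B ∈ᶜ fromℕ m → Augmentable
      top B∈ with augmentable⊎blocked B∈
      ... | inj₁ aug     = aug
      ... | inj₂ blocked = contradiction (≤fromℕ i) (ℕ.<⇒≱ (blocked⇒< blocked))

      down : ∀ j → (B ∈ᶜ suc j → Augmentable) → B ∈ᶜ inject₁ j → Augmentable
      down j next B∈ with augmentable⊎blocked B∈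
      ... | inj₁ aug     = aug
      ... | inj₂ blocked = next (blocked⇒∈next j B∈ blocked)

  exchange : ∀ A B → S A → S B → ¬ (A ⊆ᵖ B) → ∃ λ k → coord B k < coord A k × S (addUnit B k)
  exchange A B (i , A∈) (j , B∈) A⊈B with ¬∀⟶∃¬ 3 _ (λ k → coord A k ≤? coord B k) A⊈B
  ... | k₀ , A≰B = Augment.augmentable (∈C⇒∈[] A∈) {k₀} (≰⇒> A≰B) j (∈C⇒∈[] B∈)

lemma6 : (m : ℕ) (C : Fin (suc m) → Cuboid) →
         Regular m C → PolyAntimatroid (Union m C)
lemma6 m C regular = record
  { finite   = grid (hi (fromℕ m)) , λ A A∈ → ∈-grid (∈S⇒∈[origin,top] A A∈)
  ; nonempty = nonempty
  ; A1       = predecessor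
  ; A2       = exchange
  }
  where open Staircase C regular
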